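{- Let $t\ge 2$ be an integer. (1) If $G_1$ is a stitched $2$-ichromatic ordered graph with parts of sizes $n$ and $m$, then $R_t(G_1)\geq 2tr+1$, where $r = \min(n,m)-1$. (2) Let $G_2$ be a stitched $2$-ichromatic ordered graph with vertices $v_1<\dots<v_{m+n}$ and parts $\{v_1, \ldots, v_m\}$ and $\{v_{m+1}, \ldots, v_{m+n}\}$. If $v_1v_{m+n}$ and $v_mv_{m+1}$ are edges of $G_2$, then $R_t(G_2) \geq (2t+1)r+1$, where $r = \min(m,n)-1$. (3) Let $G_3$ be a $2$-ichromatic ordered graph with vertices $v_1<\dots<v_{m+n}$ and parts $\{v_1, \ldots, v_m\}$ and $\{v_{m+1}, \ldots, v_{m+n}\}$. If $v_1v_{m+1}$, $v_mv_{m+n}$ and $v_mv_{m+1}$ are edges of $G_3$, then $R_t(G_3) \geq (2t+1)r+1$, where $r = \min(m,n)-1$.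
   Context: An ordered graph is a graph together with a linear ordering of its vertices. An ordered graph $H$ is contained in an ordered graph $H'$ if there is an order-preserving injection $V(H)\to V(H')$ mapping edges to edges. An interval coloring of an ordered graph is a partition of its vertex set into independent sets each consisting of consecutive vertices (called parts); the interval chromatic number is the minimum number of parts, and an ordered graph is $k$-ichromatic if its interval chromatic number is $k$. A $k$-ichromatic ordered graph is stitched if the set consisting of the first and last vertices of each part lies in a single connected component of the graph. The $t$-color Ramsey number $R_t(G)$ of an ordered graph $G$ is the minimum $N$ such that every coloring of the edges of the ordered complete graph on $N$ vertices with $t$ colors contains a monochromatic copy of $G$ (in the ordered sense). -}

module Defs where

open import Level using (0ℓ)
open import Data.Nat using (ℕ; zero; suc; _+_; _*_; _∸_; _≤_; _<_; _⊓_)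
open import Data.Fin using (Fin; toℕ) renaming (_<_ to _<ᶠ_; _≤_ to _≤ᶠ_)
open import Data.Product using (Σ; ∃; _×_; _,_)
open import Data.Sum using (_⊎_)
open import Relation.Nullary using (¬_)
open import Relation.Binary.PropositionalEquality using (_≡_; _≢_)
open import Relation.Binary.Construct.Closure.ReflexiveTransitive using (Star)
open import Function.Bundles using (_⇔_)

record OrderedGraph (k : ℕ) : Set₁ where
  field
    Adj    : Fin k → Fin k → Set
    sym    : ∀ {i j} → Adj i j → Adj j i
    irrefl : ∀ {i} → ¬ Adj i i
open OrderedGraph public

-- An interval colouring with p parts: a partition into p nonempty parts,
-- each an independent set of consecutive vertices.  Equivalently encoded as
-- a monotone surjective map to Fin p (part q = preimage of q), parts ordered
-- left to right, with adjacent vertices in different parts.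
record IntervalColoring {k : ℕ} (G : OrderedGraph k) (p : ℕ) : Set₁ where
  field
    part       : Fin k → Fin p
    monotone   : ∀ {i j} → i ≤ᶠ j → part i ≤ᶠ part j
    surjective : ∀ q → ∃ λ i → part i ≡ q
    independent : ∀ {i j} → Adj G i j → part i ≢ part j
open IntervalColoring public

IChromatic : {k : ℕ} → OrderedGraph k → ℕ → Set₁
IChromatic G p = IntervalColoring G p × (∀ q → q < p → ¬ IntervalColoring G q)

Connected : {k : ℕ} → OrderedGraph k → Fin k → Fin k → Set
Connected G = Star (Adj G)

FirstOfPart LastOfPart : {k p : ℕ} {G : OrderedGraph k} → IntervalColoring G p → Fin k → Set
FirstOfPart c u = ∀ w → part c w ≡ part c u → u ≤ᶠ w
LastOfPart  c u = ∀ w → part c w ≡ part c u → w ≤ᶠ u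

EndOfPart : {k p : ℕ} {G : OrderedGraph k} → IntervalColoring G p → Fin k → Set
EndOfPart c u = FirstOfPart c u ⊎ LastOfPart c u

Stitched : {k p : ℕ} {G : OrderedGraph k} → IntervalColoring G p → Set
Stitched {G = G} c = ∀ u v → EndOfPart c u → EndOfPart c v → Connected G u v

-- The interval colouring has parts {v_1..v_m} and {v_{m+1}..v_{m+n}}
-- (vertices indexed from 0: first part = indices < m).
PartsSplitAt : {m n : ℕ} {G : OrderedGraph (m + n)} → IntervalColoring G 2 → Set
PartsSplitAt {m} c = ∀ v → (part c v ≡ Fin.zero) ⇔ (toℕ v < m)
  where import Data.Fin as Fin

-- Adjacency via 0-based natural-number indices.
AdjN : {k : ℕ} → OrderedGraph k → ℕ → ℕ → Set
AdjN G a b = ∃ λ i → ∃ λ j → toℕ i ≡ a × toℕ j ≡ b × Adj G i j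

-- t-edge-colourings of the ordered complete graph on N vertices:
-- the edge {a,b} with a < b receives colour χ a b.
EdgeColoring : ℕ → ℕ → Set
EdgeColoring N t = Fin N → Fin N → Fin t

HasMonoCopy : {k N t : ℕ} → OrderedGraph k → EdgeColoring N t → Set
HasMonoCopy {k} {N} {t} G χ =
  Σ (Fin t) λ col → Σ (Fin k → Fin N) λ f →
    (∀ {i j} → i <ᶠ j → f i <ᶠ f j) ×
    (∀ i j → i <ᶠ j → Adj G i j → χ (f i) (f j) ≡ col)

Arrows : {k : ℕ} → ℕ → ℕ → OrderedGraph k → Set
Arrows N t G = ∀ (χ : EdgeColoring N t) → HasMonoCopy G χ

-- R_t(G) ≥ M, where R_t(G) is the least N with Arrows N t G.
RamseyAtLeast : {k : ℕ} → ℕ → OrderedGraph k → ℕ → Set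
RamseyAtLeast t G M = ∀ N → Arrows N t G → M ≤ N

-- Cut K_N, N = B·r with r = min(m,n) − 1, into B consecutive blocks of r vertices and colour each
-- edge by the pair of blocks holding its ends. Both parts of G have more than r vertices, so a
-- monochromatic copy puts the first and last vertices of its two parts into blocks p₁ < p₂ ≤ p₃ < p₄,
-- and every edge joins a block of the first part to a block of the second that is not earlier.
-- It remains to colour pairs of blocks so that no colour class admits this. For (1), with B = 2t,
-- stitching puts the four corner blocks into one component of the bipartite graph of pairs of the
-- copy's colour, and for each colour some labelling constant on components separates them. For (2)
-- and (3), with B = 2t + 1, pairs reaching into the outer t − 2 layers are coloured by their depth,
-- which rules out the two or three prescribed edges, and the five central blocks are two-coloured by
-- an explicit table that is checked exhaustively.

module Submission where

open import Defs hiding (sym)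
open import Data.Bool using (Bool; true; false; not; _∧_; if_then_else_)
open import Data.Bool.Properties using () renaming (_≟_ to _≟ᴮ_)
open import Data.Empty using (⊥)
open import Data.Fin using (Fin; zero; suc; toℕ; fromℕ<) renaming (_<_ to _<ᶠ_; _≤_ to _≤ᶠ_)
open import Data.Fin.Properties using (toℕ-injective; toℕ-fromℕ<; toℕ<n; ¬Fin0; all?) renaming (<-cmp to <ᶠ-cmp)
open import Data.Nat using (ℕ; zero; suc; _+_; _*_; _∸_; _≤_; _<_; _⊓_; z≤n; s≤s; s≤s⁻¹; _≟_; _≤?_; _<?_; _≡ᵇ_; _<ᵇ_; NonZero)
open import Data.Nat.DivMod using (_/_; /-monoˡ-≤; m/n≡1+[m∸n]/n; m<n*o⇒m/o<n)
open import Data.Nat.Properties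
open import Data.Nat.Tactic.RingSolver using (solve-∀)
open import Data.Product using (_×_; _,_)
open import Data.Sum using (inj₁; inj₂)
open import Function.Bundles using (Equivalence)
open import Level using (0ℓ)
open import Relation.Binary using (Rel; tri<; tri≈; tri>)
open import Relation.Binary.Construct.Closure.ReflexiveTransitive using (Star; ε; _◅_; gmap)
open import Relation.Binary.Construct.Closure.Symmetric using (SymClosure; fwd; bwd)
open import Relation.Binary.PropositionalEquality using (_≡_; _≢_; refl; sym; trans; cong; subst; subst₂)
open import Relation.Nullary using (¬_; Dec; yes; no; contradiction)
open import Relation.Nullary.Decidable using (toWitness; _×-dec_; _→-dec_)

edge-crosses : ∀ {k} {G : OrderedGraph k} (c : IntervalColoring G 2) {i j} →
               i <ᶠ j → Adj G i j → part c i ≡ zero × part c j ≡ suc zero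
edge-crosses c {i} {j} i<j e with part c i | part c j | monotone c (<⇒≤ i<j) | independent c e
... | zero     | zero     | _  | i≢j = contradiction refl i≢j
... | zero     | suc zero | _  | _   = refl , refl
... | suc zero | zero     | () | _
... | suc zero | suc zero | _  | i≢j = contradiction refl i≢j

module _ {m n : ℕ} {G : OrderedGraph (m + n)} (c : IntervalColoring G 2) (split : PartsSplitAt {m} {n} c) where

  part≡zero : ∀ {v} → toℕ v < m → part c v ≡ zero
  part≡zero {v} = Equivalence.from (split v)

  part≡one⇒≥ : ∀ {v} → part c v ≡ suc zero → m ≤ toℕ v
  part≡one⇒≥ {v} eq = ≮⇒≥ λ v<m → contradiction (trans (sym (part≡zero v<m)) eq) λ ()

  part≡one : ∀ {v} → m ≤ toℕ v → part c v ≡ suc zero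
  part≡one {v} m≤v with part c v in eq
  ... | zero     = contradiction (Equivalence.to (split v) eq) (≤⇒≯ m≤v)
  ... | suc zero = refl

  first-part-nonempty : 0 < m
  first-part-nonempty with surjective c zero
  ... | v , eq = ≤-<-trans z≤n (Equivalence.to (split v) eq)

  second-part-nonempty : 0 < n
  second-part-nonempty with surjective c (suc zero)
  ... | w , eq = +-cancelˡ-< m 0 n (begin-strict
    m + 0  ≡⟨ +-identityʳ m ⟩
    m      ≤⟨ part≡one⇒≥ eq ⟩
    toℕ w  <⟨ toℕ<n w ⟩
    m + n  ∎)
    where open ≤-Reasoning

  firstVertex-end : ∀ {v} → toℕ v ≡ 0 → EndOfPart c v
  firstVertex-end v≡0 = inj₁ λ w _ → subst (_≤ _) (sym v≡0) z≤n

  lastVertex-end : ∀ {v} → suc (toℕ v) ≡ m + n → EndOfPart c v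
  lastVertex-end v≡ = inj₂ λ w _ → s≤s⁻¹ (subst (toℕ w <_) (sym v≡) (toℕ<n w))

  lastOfFirst-end : ∀ {v} → suc (toℕ v) ≡ m → EndOfPart c v
  lastOfFirst-end {v} v≡ = inj₂ λ w pw → s≤s⁻¹ (subst (toℕ w <_) (sym v≡)
    (Equivalence.to (split w) (trans pw (part≡zero (subst (toℕ v <_) v≡ ≤-refl)))))

  firstOfSecond-end : ∀ {v} → toℕ v ≡ m → EndOfPart c v
  firstOfSecond-end {v} v≡ = inj₁ λ w pw → subst (_≤ toℕ w) (sym v≡)
    (part≡one⇒≥ (trans pw (part≡one (subst (m ≤_) (sym v≡) ≤-refl))))

AdjN⇒Adj : ∀ {k} {G : OrderedGraph k} {a b} {u v : Fin k} → toℕ u ≡ a → toℕ v ≡ b → AdjN G a b → Adj G u v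
AdjN⇒Adj {G = G} u≡ v≡ (i , j , i≡ , j≡ , e) =
  subst₂ (Adj G) (toℕ-injective (trans i≡ (sym u≡))) (toℕ-injective (trans j≡ (sym v≡))) e

module _ {k N : ℕ} {f : Fin k → Fin N} (increasing : ∀ {i j} → i <ᶠ j → f i <ᶠ f j) where

  increasing⇒monotone : ∀ {i j} → i ≤ᶠ j → f i ≤ᶠ f j
  increasing⇒monotone i≤j with m≤n⇒m<n∨m≡n i≤j
  ... | inj₁ i<j = <⇒≤ (increasing i<j)
  ... | inj₂ i≡j rewrite toℕ-injective i≡j = ≤-refl

  increasing⇒expanding : ∀ d {i j} → toℕ i + d ≤ toℕ j → toℕ (f i) + d ≤ toℕ (f j)
  increasing⇒expanding zero {i} {j} h rewrite +-identityʳ (toℕ i) | +-identityʳ (toℕ (f i)) =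
    increasing⇒monotone h
  increasing⇒expanding (suc d) {i} {j} h = begin
    toℕ (f i) + suc d   ≡⟨ +-suc (toℕ (f i)) d ⟩
    suc (toℕ (f i) + d) ≤⟨ s≤s (increasing⇒expanding d (≤-reflexive (sym (toℕ-fromℕ< w<k)))) ⟩
    suc (toℕ (f w))     ≤⟨ increasing (subst (_< toℕ j) (sym (toℕ-fromℕ< w<k)) i+d<j) ⟩
    toℕ (f j)           ∎
    where
      open ≤-Reasoning
      i+d<j : toℕ i + d < toℕ j
      i+d<j = subst (_≤ toℕ j) (+-suc (toℕ i) d) h
      w<k : toℕ i + d < k
      w<k = <-trans i+d<j (toℕ<n j)
      w : Fin k
      w = fromℕ< w<k

m+n≤o⇒m/n<o/n : ∀ {m n o} .{{_ : NonZero n}} → m + n ≤ o → m / n < o / n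
m+n≤o⇒m/n<o/n {m} {n} {o} m+n≤o = begin-strict
  m / n             ≤⟨ /-monoˡ-≤ n (m+n≤o⇒m≤o∸n m m+n≤o) ⟩
  (o ∸ n) / n       <⟨ n<1+n _ ⟩
  1 + (o ∸ n) / n   ≡⟨ m/n≡1+[m∸n]/n (m+n≤o⇒n≤o m m+n≤o) ⟨
  o / n             ∎
  where open ≤-Reasoning

m<n∧m⊓o≡n⊓o⇒o≤m : ∀ {m n o} → m < n → m ⊓ o ≡ n ⊓ o → o ≤ m
m<n∧m⊓o≡n⊓o⇒o≤m {m} {n} {o} m<n eq with o ≤? m
... | yes o≤m = o≤m
... | no o≰m  = contradiction (trans (sym (m≤n⇒m⊓n≡m (<⇒≤ (≰⇒> o≰m)))) eq) (<⇒≢ (⊓-glb m<n (≰⇒> o≰m)))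

Chain : ℕ → ℕ → ℕ → ℕ → ℕ → Set
Chain n a k k₂ b = a < k × k ≤ k₂ × k₂ < b × b ≤ n

allFin⇒all≤ : ∀ n {P : ℕ → Set} → (∀ (x : Fin (suc n)) → P (toℕ x)) → ∀ {x} → x ≤ n → P x
allFin⇒all≤ n {P} h {x} x≤n = subst P (toℕ-fromℕ< (s≤s x≤n)) (h (fromℕ< (s≤s x≤n)))

allFin⇒all≤² : ∀ n {P : ℕ → ℕ → Set} → (∀ (x y : Fin (suc n)) → P (toℕ x) (toℕ y)) →
               ∀ {x y} → x ≤ n → y ≤ n → P x y
allFin⇒all≤² n {P} h x≤n = allFin⇒all≤ n {P _} (allFin⇒all≤ n {λ x → ∀ y → P x (toℕ y)} h x≤n)

allFin⇒allChain : ∀ n {P : ℕ → ℕ → ℕ → ℕ → Set} →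
                  (∀ (a k k₂ b : Fin (suc n)) → Chain n (toℕ a) (toℕ k) (toℕ k₂) (toℕ b) →
                    P (toℕ a) (toℕ k) (toℕ k₂) (toℕ b)) →
                  ∀ {a k k₂ b} → Chain n a k k₂ b → P a k k₂ b
allFin⇒allChain n {P} h {a} {k} {k₂} {b} chain@(a<k , k≤k₂ , k₂<b , b≤n) =
  allFin⇒all≤² n {λ k₂ b → Chain n a k k₂ b → P a k k₂ b}
    (allFin⇒all≤² n {λ a k → ∀ k₂ b → Chain n a k (toℕ k₂) (toℕ b) → P a k (toℕ k₂) (toℕ b)} h a≤n k≤n)
    k₂≤n b≤n chain
  where
    k₂≤n : k₂ ≤ n
    k₂≤n = ≤-trans (<⇒≤ k₂<b) b≤n
    k≤n : k ≤ n
    k≤n = ≤-trans k≤k₂ k₂≤n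
    a≤n : a ≤ n
    a≤n = ≤-trans (<⇒≤ a<k) k≤n

chain? : ∀ n (a k k₂ b : Fin (suc n)) → Dec (Chain n (toℕ a) (toℕ k) (toℕ k₂) (toℕ b))
chain? n a k k₂ b = (toℕ a <? toℕ k) ×-dec (toℕ k ≤? toℕ k₂) ×-dec (toℕ k₂ <? toℕ b) ×-dec (toℕ b ≤? n)

-- Blow-ups of colourings of pairs of blocks

-- Bounded only constrains κ on pairs p ≤ q, the only ones an increasing copy meets; clamp makes the
-- colouring total.
clamp : (T : ℕ) → ℕ → Fin (suc T)
clamp T a = fromℕ< (s≤s (m⊓n≤n a T))

toℕ-clamp : ∀ {T a} → a ≤ T → toℕ (clamp T a) ≡ a
toℕ-clamp {T} {a} a≤T = trans (toℕ-fromℕ< (s≤s (m⊓n≤n a T))) (m≤n⇒m⊓n≡m a≤T)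

Bounded : ℕ → (ℕ → ℕ → ℕ) → Set
Bounded T κ = ∀ {p q} → p ≤ q → κ p q ≤ T

blowUp : (T r : ℕ) .{{_ : NonZero r}} → (ℕ → ℕ → ℕ) → ∀ {N} → EdgeColoring N (suc T)
blowUp T r κ x y = clamp T (κ (toℕ x / r) (toℕ y / r))

record BlockCopy {k : ℕ} (G : OrderedGraph k) (T r B : ℕ) (κ : ℕ → ℕ → ℕ) : Set where
  field
    colour       : ℕ
    colour≤T     : colour ≤ T
    block        : Fin k → ℕ
    block-mono   : ∀ {i j} → i ≤ᶠ j → block i ≤ block j
    block-spread : ∀ {i j} → toℕ i + r ≤ toℕ j → block i < block j
    block-bound  : ∀ i → block i < B
    block-colour : ∀ {i j} → i <ᶠ j → Adj G i j → κ (block i) (block j) ≡ colour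

monoCopy⇒BlockCopy : ∀ {k T r B N} .{{_ : NonZero r}} {G : OrderedGraph k} {κ : ℕ → ℕ → ℕ} →
                     Bounded T κ → N ≤ B * r → HasMonoCopy G (blowUp T r κ {N}) → BlockCopy G T r B κ
monoCopy⇒BlockCopy {k} {r = r} bounded N≤B*r (col , f , increasing , mono) = record
  { colour       = toℕ col
  ; colour≤T     = s≤s⁻¹ (toℕ<n col)
  ; block        = block
  ; block-mono   = block-mono
  ; block-spread = λ h → m+n≤o⇒m/n<o/n (increasing⇒expanding increasing r h)
  ; block-bound  = λ i → m<n*o⇒m/o<n (<-≤-trans (toℕ<n (f i)) N≤B*r)
  ; block-colour = λ {i} {j} i<j e →
      trans (sym (toℕ-clamp (bounded (block-mono (<⇒≤ i<j))))) (cong toℕ (mono i j i<j e))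
  }
  where
    block : Fin k → ℕ
    block i = toℕ (f i) / r
    block-mono : ∀ {i j} → i ≤ᶠ j → block i ≤ block j
    block-mono i≤j = /-monoˡ-≤ r (increasing⇒monotone increasing i≤j)

blowUp-noArrows : ∀ {k T} {G : OrderedGraph k} {κ : ℕ → ℕ → ℕ} → Bounded T κ → Fin k →
                  ∀ B r → ¬ BlockCopy G T r B κ → ∀ {N} → N ≤ B * r → ¬ Arrows N (suc T) G
blowUp-noArrows _ v B zero _ {N} N≤0 arrows with n≤0⇒n≡0 (subst (N ≤_) (*-zeroʳ B) N≤0)
... | refl with arrows (λ ())
...   | _ , f , _ = ¬Fin0 (f v)
blowUp-noArrows {κ = κ} bounded _ B (suc r) noCopy N≤B*r arrows =
  noCopy (monoCopy⇒BlockCopy bounded N≤B*r (arrows (blowUp _ (suc r) κ)))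

blowUp-lowerBound : ∀ {k T} {G : OrderedGraph k} {κ : ℕ → ℕ → ℕ} → Bounded T κ → Fin k →
                    ∀ B r → ¬ BlockCopy G T r B κ → RamseyAtLeast (suc T) G (B * r + 1)
blowUp-lowerBound bounded v B r noCopy N arrows =
  subst (_≤ N) (+-comm 1 (B * r)) (≰⇒> λ N≤B*r → blowUp-noArrows bounded v B r noCopy N≤B*r arrows)

-- (s , p) is block p on the side of part s; Linked B κ c is the connectivity of the bipartite graph
-- whose edges are the pairs of blocks of colour c.
data ColourPair (B : ℕ) (κ : ℕ → ℕ → ℕ) (c : ℕ) : Rel (Fin 2 × ℕ) 0ℓ where
  pair : ∀ {p q} → p ≤ q → q < B → κ p q ≡ c → ColourPair B κ c (zero , p) (suc zero , q)

Linked : ℕ → (ℕ → ℕ → ℕ) → ℕ → Rel (Fin 2 × ℕ) 0ℓ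
Linked B κ c = Star (SymClosure (ColourPair B κ c))

Linked-invariant : ∀ {B κ c} {A : Set} (L : Fin 2 × ℕ → A) →
                   (∀ {p q} → p ≤ q → q < B → κ p q ≡ c → L (zero , p) ≡ L (suc zero , q)) →
                   ∀ {x y} → Linked B κ c x y → L x ≡ L y
Linked-invariant L inv ε = refl
Linked-invariant L inv (fwd (pair p≤q q<B eq) ◅ xs) = trans (inv p≤q q<B eq) (Linked-invariant L inv xs)
Linked-invariant L inv (bwd (pair p≤q q<B eq) ◅ xs) = trans (sym (inv p≤q q<B eq)) (Linked-invariant L inv xs)

module _ {k T r B : ℕ} {G : OrderedGraph k} {κ : ℕ → ℕ → ℕ} (c : IntervalColoring G 2) (copy : BlockCopy G T r B κ) where
  open BlockCopy copy

  position : Fin k → Fin 2 × ℕ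
  position u = part c u , block u

  edge⇒ColourPair : ∀ {i j} → i <ᶠ j → Adj G i j → ColourPair B κ colour (position i) (position j)
  edge⇒ColourPair {i} {j} i<j e with edge-crosses c i<j e
  ... | part-i , part-j rewrite part-i | part-j =
    pair (block-mono (<⇒≤ i<j)) (block-bound j) (block-colour i<j e)

  Connected⇒Linked : ∀ {u v} → Connected G u v → Linked B κ colour (position u) (position v)
  Connected⇒Linked = gmap position edge
    where
      edge : ∀ {i j} → Adj G i j → SymClosure (ColourPair B κ colour) (position i) (position j)
      edge {i} {j} e with <ᶠ-cmp i j
      ... | tri< i<j _ _ = fwd (edge⇒ColourPair i<j e)
      ... | tri≈ _ refl _ = contradiction e (irrefl G)
      ... | tri> _ _ j<i = bwd (edge⇒ColourPair j<i (OrderedGraph.sym G e))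

module Corners {m' n' : ℕ} {G : OrderedGraph (suc m' + suc n')} (c : IntervalColoring G 2)
               (split : PartsSplitAt {suc m'} {suc n'} c)
               {T r B : ℕ} {κ : ℕ → ℕ → ℕ} (copy : BlockCopy G T r B κ) (r≤m' : r ≤ m') (r≤n' : r ≤ n') where
  open BlockCopy copy

  -- The vertices v₁, vₘ, vₘ₊₁, vₘ₊ₙ of the paper for m = suc m', n = suc n'; positions are 0-based.
  v₁ vₘ vₘ₊₁ vₘ₊ₙ : Fin (suc m' + suc n')
  v₁   = zero
  vₘ   = fromℕ< (s≤s (m≤m+n m' (suc n')))
  vₘ₊₁ = fromℕ< (s≤s (m<m+n m' {suc n'} (s≤s z≤n)))
  vₘ₊ₙ = fromℕ< ≤-refl

  toℕ-vₘ : toℕ vₘ ≡ m'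
  toℕ-vₘ = toℕ-fromℕ< _

  toℕ-vₘ₊₁ : toℕ vₘ₊₁ ≡ suc m'
  toℕ-vₘ₊₁ = toℕ-fromℕ< (s≤s (m<m+n m' {suc n'} (s≤s z≤n)))

  toℕ-vₘ₊ₙ : toℕ vₘ₊ₙ ≡ m' + suc n'
  toℕ-vₘ₊ₙ = toℕ-fromℕ< _

  b₁<bₘ : block v₁ < block vₘ
  b₁<bₘ = block-spread (subst (r ≤_) (sym toℕ-vₘ) r≤m')

  bₘ≤bₘ₊₁ : block vₘ ≤ block vₘ₊₁
  bₘ≤bₘ₊₁ = block-mono (subst₂ _≤_ (sym toℕ-vₘ) (sym toℕ-vₘ₊₁) (n≤1+n m'))

  bₘ₊₁<bₘ₊ₙ : block vₘ₊₁ < block vₘ₊ₙ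
  bₘ₊₁<bₘ₊ₙ = block-spread (subst₂ _≤_ (cong (_+ r) (sym toℕ-vₘ₊₁)) (trans (sym (+-suc m' n')) (sym toℕ-vₘ₊ₙ))
                                     (s≤s (+-monoʳ-≤ m' r≤n')))

  bₘ₊ₙ<B : block vₘ₊ₙ < B
  bₘ₊ₙ<B = block-bound vₘ₊ₙ

  edge-colour : ∀ {u v a b} → toℕ u ≡ a → toℕ v ≡ b → a < b → AdjN G a b → κ (block u) (block v) ≡ colour
  edge-colour u≡a v≡b a<b e = block-colour (subst₂ _<_ (sym u≡a) (sym v≡b) a<b) (AdjN⇒Adj {G = G} u≡a v≡b e)

  module _ (stitched : Stitched c) where

    linked : ∀ {u v s s'} → EndOfPart c u → EndOfPart c v → part c u ≡ s → part c v ≡ s' →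
             Linked B κ colour (s , block u) (s' , block v)
    linked {u} {v} eu ev refl refl = Connected⇒Linked c copy (stitched u v eu ev)

    linkedₘ : Linked B κ colour (zero , block v₁) (zero , block vₘ)
    linkedₘ = linked (firstVertex-end c split refl) (lastOfFirst-end c split (cong suc toℕ-vₘ))
                     (part≡zero c split (s≤s z≤n)) (part≡zero c split (s≤s (≤-reflexive toℕ-vₘ)))

    linkedₘ₊₁ : Linked B κ colour (zero , block v₁) (suc zero , block vₘ₊₁)
    linkedₘ₊₁ = linked (firstVertex-end c split refl) (firstOfSecond-end c split toℕ-vₘ₊₁)
                       (part≡zero c split (s≤s z≤n)) (part≡one c split (≤-reflexive (sym toℕ-vₘ₊₁)))

    linkedₘ₊ₙ : Linked B κ colour (zero , block v₁) (suc zero , block vₘ₊ₙ)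
    linkedₘ₊ₙ = linked (firstVertex-end c split refl) (lastVertex-end c split (cong suc toℕ-vₘ₊ₙ))
                       (part≡zero c split (s≤s z≤n))
                       (part≡one c split (subst (suc m' ≤_) (sym toℕ-vₘ₊ₙ) (m<m+n m' (s≤s z≤n))))

-- Part (1)

last₁ : ℕ → ℕ
last₁ T = T + suc T

<2[1+T]⇒≤last₁ : ∀ {T q} → q < 2 * suc T → q ≤ last₁ T
<2[1+T]⇒≤last₁ {T} {q} q< = s≤s⁻¹ (subst (q <_) (cong (λ x → suc (T + x)) (+-identityʳ (suc T))) q<)

-- The 2t blocks are 0 … last₁ T; the antidiagonal gets the top colour T.
colouring₁ : ℕ → ℕ → ℕ → ℕ
colouring₁ T p q with p + q ≟ last₁ T
... | yes _ = T
... | no _  = p ⊓ (last₁ T ∸ q)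

colouring₁-bounded : ∀ T → Bounded T (colouring₁ T)
colouring₁-bounded T {p} {q} p≤q with p + q ≟ last₁ T
... | yes _ = ≤-refl
... | no _ with p ≤? T
...   | yes p≤T = ≤-trans (m⊓n≤m p _) p≤T
...   | no p≰T  = begin
  p ⊓ (last₁ T ∸ q)      ≤⟨ m⊓n≤n p _ ⟩
  last₁ T ∸ q            ≤⟨ ∸-monoʳ-≤ (last₁ T) (≤-trans (≰⇒> p≰T) p≤q) ⟩
  last₁ T ∸ suc T        ≡⟨ m+n∸n≡m T (suc T) ⟩
  T                      ∎
  where open ≤-Reasoning

-- In colour c < T, block c of the first part is paired only with blocks other than last₁ T ∸ c, and
-- every other block of the first part only with last₁ T ∸ c.
module _ (T c : ℕ) where

  indicator : Fin 2 × ℕ → Bool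
  indicator (zero , p) with p ≟ c
  ... | yes _ = true
  ... | no _  = false
  indicator (suc zero , q) with q ≟ last₁ T ∸ c
  ... | yes _ = false
  ... | no _  = true

  indicator-invariant : c < T → ∀ {p q} → q ≤ last₁ T → colouring₁ T p q ≡ c →
                        indicator (zero , p) ≡ indicator (suc zero , q)
  indicator-invariant c<T {p} {q} q≤last h with p + q ≟ last₁ T | p ≟ c | q ≟ last₁ T ∸ c
  ... | yes _ | _ | _ = contradiction h (>⇒≢ c<T)
  ... | no p+q≢last | yes refl | yes refl = contradiction (m+[n∸m]≡n c≤last) p+q≢last
    where
      c≤last : c ≤ last₁ T
      c≤last = ≤-trans (<⇒≤ c<T) (m≤m+n T (suc T))
  ... | no _ | yes _ | no _ = refl
  ... | no _ | no _  | yes _ = refl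
  ... | no _ | no p≢c | no q≢last-c with ⊓-sel p (last₁ T ∸ q)
  ...   | inj₁ eq = contradiction (trans (sym eq) h) p≢c
  ...   | inj₂ eq = contradiction (trans (sym (m∸[m∸n]≡n q≤last)) (cong (last₁ T ∸_) (trans (sym eq) h))) q≢last-c

  indicator-separates : ∀ {p₁ p₂ p₃ p₄} → p₁ < p₂ → p₃ < p₄ →
                        indicator (zero , p₁) ≡ indicator (zero , p₂) →
                        indicator (zero , p₁) ≡ indicator (suc zero , p₃) →
                        indicator (zero , p₁) ≡ indicator (suc zero , p₄) → ⊥
  indicator-separates {p₁} {p₂} {p₃} {p₄} p₁<p₂ p₃<p₄ l₂ l₃ l₄
    with p₁ ≟ c | p₂ ≟ c | p₃ ≟ last₁ T ∸ c | p₄ ≟ last₁ T ∸ c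
  ... | yes refl | yes refl | _        | _        = <-irrefl refl p₁<p₂
  ... | yes _    | no _     | _        | _        = contradiction l₂ λ ()
  ... | no _     | _        | yes refl | yes refl = <-irrefl refl p₃<p₄
  ... | no _     | _        | no _     | _        = contradiction l₃ λ ()
  ... | no _     | _        | yes _    | no _     = contradiction l₄ λ ()

depth : ℕ → Fin 2 × ℕ → ℕ
depth T (zero , p)     = p ⊓ T
depth T (suc zero , q) = (last₁ T ∸ q) ⊓ T

depth-invariant : ∀ T {p q} → colouring₁ T p q ≡ T → depth T (zero , p) ≡ depth T (suc zero , q)
depth-invariant T {p} {q} h with p + q ≟ last₁ T
... | yes p+q≡last = cong (_⊓ T) (sym (trans (cong (_∸ q) (sym p+q≡last)) (m+n∸n≡m p q)))
... | no _ = trans (m≥n⇒m⊓n≡n (subst (_≤ p) h (m⊓n≤m p _))) (sym (m≥n⇒m⊓n≡n (subst (_≤ _) h (m⊓n≤n p _))))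

depth-separates : ∀ T {p₁ p₂ p₃ p₄} → p₁ < p₂ → p₂ ≤ p₃ → p₃ < p₄ → p₄ ≤ last₁ T →
                  depth T (zero , p₁) ≡ depth T (zero , p₂) →
                  depth T (zero , p₁) ≡ depth T (suc zero , p₄) → ⊥
depth-separates T {p₁} {p₂} {p₃} {p₄} p₁<p₂ p₂≤p₃ p₃<p₄ p₄≤last l₂ l₄ = ≤⇒≯ p₄≤1+T 2+T≤p₄
  where
    T≤p₁ : T ≤ p₁
    T≤p₁ = m<n∧m⊓o≡n⊓o⇒o≤m p₁<p₂ l₂
    T≤last∸p₄ : T ≤ last₁ T ∸ p₄
    T≤last∸p₄ = subst (_≤ last₁ T ∸ p₄) (trans (sym l₄) (m≥n⇒m⊓n≡n T≤p₁)) (m⊓n≤m _ T)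
    p₄≤1+T : p₄ ≤ suc T
    p₄≤1+T = +-cancelˡ-≤ T p₄ (suc T) (m≤o∸n⇒m+n≤o T p₄≤last T≤last∸p₄)
    2+T≤p₄ : suc (suc T) ≤ p₄
    2+T≤p₄ = ≤-trans (s≤s (<-≤-trans (s≤s T≤p₁) (≤-trans p₁<p₂ p₂≤p₃))) p₃<p₄

colouring₁-noCorners : ∀ T {c p₁ p₂ p₃ p₄} → c ≤ T → p₁ < p₂ → p₂ ≤ p₃ → p₃ < p₄ → p₄ < 2 * suc T →
                       Linked (2 * suc T) (colouring₁ T) c (zero , p₁) (zero , p₂) →
                       Linked (2 * suc T) (colouring₁ T) c (zero , p₁) (suc zero , p₃) →
                       Linked (2 * suc T) (colouring₁ T) c (zero , p₁) (suc zero , p₄) → ⊥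
colouring₁-noCorners T {c} c≤T p₁<p₂ p₂≤p₃ p₃<p₄ p₄<B l₂ l₃ l₄ with m≤n⇒m<n∨m≡n c≤T
... | inj₁ c<T = indicator-separates T c p₁<p₂ p₃<p₄ (label l₂) (label l₃) (label l₄)
  where
    label : ∀ {x y} → Linked (2 * suc T) (colouring₁ T) c x y → indicator T c x ≡ indicator T c y
    label = Linked-invariant (indicator T c) (λ _ q<B → indicator-invariant T c c<T (<2[1+T]⇒≤last₁ q<B))
... | inj₂ refl = depth-separates T p₁<p₂ p₂≤p₃ p₃<p₄ (<2[1+T]⇒≤last₁ p₄<B) (label l₂) (label l₄)
  where
    label : ∀ {x y} → Linked (2 * suc T) (colouring₁ T) T x y → depth T x ≡ depth T y
    label = Linked-invariant (depth T) (λ _ _ → depth-invariant T)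

part₁ : ∀ T (m n : ℕ) (G : OrderedGraph (m + n)) (c : IntervalColoring G 2) →
        PartsSplitAt {m} {n} c → Stitched c → RamseyAtLeast (suc T) G (2 * suc T * (m ⊓ n ∸ 1) + 1)
part₁ T zero n G c split _ = contradiction (first-part-nonempty c split) λ ()
part₁ T (suc m') zero G c split _ = contradiction (second-part-nonempty c split) λ ()
part₁ T (suc m') (suc n') G c split stitched =
  blowUp-lowerBound (colouring₁-bounded T) zero (2 * suc T) (m' ⊓ n') noCopy
  where
    noCopy : ¬ BlockCopy G T (m' ⊓ n') (2 * suc T) (colouring₁ T)
    noCopy copy = colouring₁-noCorners T colour≤T b₁<bₘ bₘ≤bₘ₊₁ bₘ₊₁<bₘ₊ₙ bₘ₊ₙ<B
                                    (linkedₘ stitched) (linkedₘ₊₁ stitched) (linkedₘ₊ₙ stitched)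
      where
        open BlockCopy copy
        open Corners c split copy (m⊓n≤m m' n') (m⊓n≤n m' n')

-- Layered colourings for parts (2) and (3)

last₂ : ℕ → ℕ
last₂ S = S + (S + 4)

<2[2+S]+1⇒≤last₂ : ∀ {S q} → q < 2 * suc (suc S) + 1 → q ≤ last₂ S
<2[2+S]+1⇒≤last₂ {S} {q} q< = s≤s⁻¹ (subst (q <_) (blocks S) q<)
  where
    blocks : ∀ S → 2 * suc (suc S) + 1 ≡ suc (S + (S + 4))
    blocks = solve-∀

coreColour : ℕ → Bool → ℕ
coreColour S b = if b then suc S else S

S≤coreColour : ∀ S b → S ≤ coreColour S b
S≤coreColour S true  = n≤1+n S
S≤coreColour S false = ≤-refl

coreColour≤1+S : ∀ S b → coreColour S b ≤ suc S
coreColour≤1+S S true  = ≤-refl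
coreColour≤1+S S false = n≤1+n S

coreColour-injective : ∀ S {b b'} → coreColour S b ≡ coreColour S b' → b ≡ b'
coreColour-injective S {true}  {true}  _  = refl
coreColour-injective S {false} {false} _  = refl
coreColour-injective S {true}  {false} eq = contradiction (sym eq) (<⇒≢ (n<1+n S))
coreColour-injective S {false} {true}  eq = contradiction eq (<⇒≢ (n<1+n S))

-- The 2t + 1 blocks are 0 … last₂ S. A pair of depth below S gets its depth; all other pairs lie in
-- the five central blocks S … S + 4, where the table chooses between the colours S and S + 1.
layered : (ℕ → ℕ → Bool) → ℕ → ℕ → ℕ → ℕ
layered table S p q with p ⊓ (last₂ S ∸ q) <? S
... | yes _ = p ⊓ (last₂ S ∸ q)
... | no _  = coreColour S (table (p ∸ S) (q ∸ S))

layered-bounded : ∀ table S → Bounded (suc S) (layered table S)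
layered-bounded table S {p} {q} _ with p ⊓ (last₂ S ∸ q) <? S
... | yes d<S = ≤-trans (<⇒≤ d<S) (n≤1+n S)
... | no _    = coreColour≤1+S S _

data LayeredView (table : ℕ → ℕ → Bool) (S p q c : ℕ) : Set where
  outer : c < S → c ≤ p → c ≤ last₂ S ∸ q → p ⊓ (last₂ S ∸ q) ≡ c → LayeredView table S p q c
  inner : S ≤ p → q ≤ S + 4 → coreColour S (table (p ∸ S) (q ∸ S)) ≡ c → LayeredView table S p q c

layered-view : ∀ table S {p q c} → q ≤ last₂ S → layered table S p q ≡ c → LayeredView table S p q c
layered-view table S {p} {q} q≤last h with p ⊓ (last₂ S ∸ q) <? S
... | yes d<S = outer (subst (_< S) h d<S) (subst (_≤ p) h (m⊓n≤m p _)) (subst (_≤ _) h (m⊓n≤n p _)) h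
... | no d≮S  = inner (≤-trans S≤d (m⊓n≤m p _)) q≤S+4 h
  where
    S≤d : S ≤ p ⊓ (last₂ S ∸ q)
    S≤d = ≮⇒≥ d≮S
    q≤S+4 : q ≤ S + 4
    q≤S+4 = +-cancelˡ-≤ S q (S + 4)
      (≤-trans (+-monoˡ-≤ q (≤-trans S≤d (m⊓n≤n p _))) (≤-reflexive (m∸n+n≡m q≤last)))

outer≢inner : ∀ {S c} b → c < S → coreColour S b ≢ c
outer≢inner b c<S eq = <⇒≱ c<S (subst (_ ≤_) eq (S≤coreColour _ b))

outer-contradiction : ∀ K {a k k₂ b c} → c ≤ a → a < k → k₂ < b → b ≤ K → c ≤ K ∸ b →
                      k ⊓ (K ∸ k₂) ≡ c → ⊥
outer-contradiction K {k = k} {k₂} c≤a a<k k₂<b b≤K c≤K∸b eq with ⊓-sel k (K ∸ k₂)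
... | inj₁ ⊓≡k  = <⇒≢ (≤-<-trans c≤a a<k) (trans (sym eq) ⊓≡k)
... | inj₂ ⊓≡K∸k₂ = <⇒≢ (≤-<-trans c≤K∸b (∸-monoʳ-< k₂<b b≤K)) (trans (sym eq) ⊓≡K∸k₂)

central-chain : ∀ S {a k k₂ b} → S ≤ a → a < k → k ≤ k₂ → k₂ < b → b ≤ S + 4 → Chain 4 (a ∸ S) (k ∸ S) (k₂ ∸ S) (b ∸ S)
central-chain S S≤a a<k k≤k₂ k₂<b b≤S+4 =
  ∸-monoˡ-< a<k S≤a , ∸-monoˡ-≤ S k≤k₂ ,
  ∸-monoˡ-< k₂<b (≤-trans S≤a (≤-trans (<⇒≤ a<k) k≤k₂)) , m≤n+o⇒m∸n≤o _ S b≤S+4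

-- Part (2)

table₂ : ℕ → ℕ → Bool
table₂ 0 4 = true
table₂ 1 1 = true
table₂ 1 2 = true
table₂ 2 2 = true
table₂ 2 3 = true
table₂ 3 3 = true
table₂ _ _ = false

colouring₂ : ℕ → ℕ → ℕ → ℕ
colouring₂ = layered table₂

-- In colour S + 1 the central pair (0, 4) shares no block with the other central pairs.
endLabel : ℕ → Fin 2 × ℕ → Bool
endLabel S (zero , p)     = (p ∸ S) ≡ᵇ 0
endLabel S (suc zero , q) = (q ∸ S) ≡ᵇ 4

table₂-endLabel : ∀ {p q} → p ≤ 4 → q ≤ 4 → table₂ p q ≡ true → (p ≡ᵇ 0) ≡ (q ≡ᵇ 4)
table₂-endLabel = allFin⇒all≤² 4 {λ p q → table₂ p q ≡ true → (p ≡ᵇ 0) ≡ (q ≡ᵇ 4)}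
  (toWitness {a? = all? λ p → all? λ q →
    (table₂ (toℕ p) (toℕ q) ≟ᴮ true) →-dec ((toℕ p ≡ᵇ 0) ≟ᴮ (toℕ q ≡ᵇ 4))} _)

endLabel-invariant : ∀ S {p q} → p ≤ q → q ≤ last₂ S → colouring₂ S p q ≡ suc S →
                     endLabel S (zero , p) ≡ endLabel S (suc zero , q)
endLabel-invariant S {p} {q} p≤q q≤last h with layered-view table₂ S q≤last h
... | outer 1+S<S _ _ _ = contradiction 1+S<S (≤⇒≯ (n≤1+n S))
... | inner _ q≤S+4 e   =
  table₂-endLabel (m≤n+o⇒m∸n≤o p S (≤-trans p≤q q≤S+4)) (m≤n+o⇒m∸n≤o q S q≤S+4) (coreColour-injective S e)

table₂-noNestedPair : ∀ {a k k₂ b} → Chain 4 a k k₂ b → table₂ a b ≡ table₂ k k₂ →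
                      (table₂ a b ≡ true → (a ≡ᵇ 0) ≡ (k ≡ᵇ 0)) → ⊥
table₂-noNestedPair = allFin⇒allChain 4
  {λ a k k₂ b → table₂ a b ≡ table₂ k k₂ → (table₂ a b ≡ true → (a ≡ᵇ 0) ≡ (k ≡ᵇ 0)) → ⊥}
  (toWitness {a? = all? λ a → all? λ k → all? λ k₂ → all? λ b →
    chain? 4 a k k₂ b →-dec (table₂ (toℕ a) (toℕ b) ≟ᴮ table₂ (toℕ k) (toℕ k₂)) →-dec
    ((table₂ (toℕ a) (toℕ b) ≟ᴮ true) →-dec ((toℕ a ≡ᵇ 0) ≟ᴮ (toℕ k ≡ᵇ 0))) →-dec no (λ ())} _)

colouring₂-noCorners : ∀ S {c a k k₂ b} → a < k → k ≤ k₂ → k₂ < b → b ≤ last₂ S →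
                       colouring₂ S a b ≡ c → colouring₂ S k k₂ ≡ c →
                       Linked (2 * suc (suc S) + 1) (colouring₂ S) c (zero , a) (zero , k) → ⊥
colouring₂-noCorners S {c} {a} {k} {k₂} {b} a<k k≤k₂ k₂<b b≤last h₁ h₂ linked
  with layered-view table₂ S b≤last h₁ | layered-view table₂ S (≤-trans (<⇒≤ k₂<b) b≤last) h₂
... | outer _ c≤a c≤last∸b _ | outer _ _ _ e₂ = outer-contradiction (last₂ S) c≤a a<k k₂<b b≤last c≤last∸b e₂
... | outer c<S _ _ _ | inner _ _ e₂    = outer≢inner _ c<S e₂
... | inner _ _ e₁    | outer c<S _ _ _ = outer≢inner _ c<S e₁
... | inner S≤a b≤S+4 e₁ | inner _ _ e₂ =
  table₂-noNestedPair (central-chain S S≤a a<k k≤k₂ k₂<b b≤S+4) (coreColour-injective S (trans e₁ (sym e₂))) endLabels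
  where
    endLabels : table₂ (a ∸ S) (b ∸ S) ≡ true → endLabel S (zero , a) ≡ endLabel S (zero , k)
    endLabels central = Linked-invariant (endLabel S)
      (λ p≤q q<B → endLabel-invariant S p≤q (<2[2+S]+1⇒≤last₂ q<B))
      (subst (λ c → Linked _ _ c _ _) (trans (sym e₁) (cong (coreColour S) central)) linked)

part₂ : ∀ S (m n : ℕ) (G : OrderedGraph (m + n)) (c : IntervalColoring G 2) → PartsSplitAt {m} {n} c →
        Stitched c → AdjN G 0 (m + n ∸ 1) → AdjN G (m ∸ 1) m →
        RamseyAtLeast (suc (suc S)) G ((2 * suc (suc S) + 1) * (m ⊓ n ∸ 1) + 1)
part₂ S zero n G c split _ _ _ = contradiction (first-part-nonempty c split) λ ()
part₂ S (suc m') zero G c split _ _ _ = contradiction (second-part-nonempty c split) λ ()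
part₂ S (suc m') (suc n') G c split stitched adj₁ adj₂ =
  blowUp-lowerBound (layered-bounded table₂ S) zero (2 * suc (suc S) + 1) (m' ⊓ n') noCopy
  where
    noCopy : ¬ BlockCopy G (suc S) (m' ⊓ n') (2 * suc (suc S) + 1) (colouring₂ S)
    noCopy copy = colouring₂-noCorners S b₁<bₘ bₘ≤bₘ₊₁ bₘ₊₁<bₘ₊ₙ (<2[2+S]+1⇒≤last₂ bₘ₊ₙ<B)
                    (edge-colour refl toℕ-vₘ₊ₙ (≤-trans (s≤s z≤n) (m≤n+m (suc n') m')) adj₁)
                    (edge-colour toℕ-vₘ toℕ-vₘ₊₁ (n<1+n m') adj₂)
                    (linkedₘ stitched)
      where open Corners c split copy (m⊓n≤m m' n') (m⊓n≤n m' n')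

-- Part (3)

table₃ : ℕ → ℕ → Bool
table₃ p q = (0 <ᵇ p) ∧ not (q ≡ᵇ suc p)

colouring₃ : ℕ → ℕ → ℕ → ℕ
colouring₃ = layered table₃

table₃-noPath : ∀ {a k k₂ b} → Chain 4 a k k₂ b → table₃ a k₂ ≡ table₃ k k₂ → table₃ k k₂ ≡ table₃ k b → ⊥
table₃-noPath = allFin⇒allChain 4 {λ a k k₂ b → table₃ a k₂ ≡ table₃ k k₂ → table₃ k k₂ ≡ table₃ k b → ⊥}
  (toWitness {a? = all? λ a → all? λ k → all? λ k₂ → all? λ b →
  chain? 4 a k k₂ b →-dec (table₃ (toℕ a) (toℕ k₂) ≟ᴮ table₃ (toℕ k) (toℕ k₂)) →-dec
  (table₃ (toℕ k) (toℕ k₂) ≟ᴮ table₃ (toℕ k) (toℕ b)) →-dec no (λ ())} _)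

colouring₃-noCorners : ∀ S {c a k k₂ b} → a < k → k ≤ k₂ → k₂ < b → b ≤ last₂ S →
                       colouring₃ S a k₂ ≡ c → colouring₃ S k k₂ ≡ c → colouring₃ S k b ≡ c → ⊥
colouring₃-noCorners S a<k k≤k₂ k₂<b b≤last h₁ h₂ h₃
  with layered-view table₃ S (≤-trans (<⇒≤ k₂<b) b≤last) h₁
     | layered-view table₃ S (≤-trans (<⇒≤ k₂<b) b≤last) h₂
     | layered-view table₃ S b≤last h₃
... | outer _ c≤a _ _ | outer _ _ _ e₂ | outer _ _ c≤last∸b _ =
  outer-contradiction (last₂ S) c≤a a<k k₂<b b≤last c≤last∸b e₂
... | outer c<S _ _ _ | inner _ _ e₂    | _               = outer≢inner _ c<S e₂
... | outer c<S _ _ _ | outer _ _ _ _   | inner _ _ e₃    = outer≢inner _ c<S e₃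
... | inner _ _ e₁    | outer c<S _ _ _ | _               = outer≢inner _ c<S e₁
... | inner _ _ e₁    | inner _ _ _     | outer c<S _ _ _ = outer≢inner _ c<S e₁
... | inner S≤a _ e₁ | inner _ _ e₂ | inner _ b≤S+4 e₃ =
  table₃-noPath (central-chain S S≤a a<k k≤k₂ k₂<b b≤S+4)
                (coreColour-injective S (trans e₁ (sym e₂))) (coreColour-injective S (trans e₂ (sym e₃)))

part₃ : ∀ S (m n : ℕ) (G : OrderedGraph (m + n)) (c : IntervalColoring G 2) → PartsSplitAt {m} {n} c →
        AdjN G 0 m → AdjN G (m ∸ 1) (m + n ∸ 1) → AdjN G (m ∸ 1) m →
        RamseyAtLeast (suc (suc S)) G ((2 * suc (suc S) + 1) * (m ⊓ n ∸ 1) + 1)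
part₃ S zero n G c split _ _ _ = contradiction (first-part-nonempty c split) λ ()
part₃ S (suc m') zero G c split _ _ _ = contradiction (second-part-nonempty c split) λ ()
part₃ S (suc m') (suc n') G c split adj₁ adj₂ adj₃ =
  blowUp-lowerBound (layered-bounded table₃ S) zero (2 * suc (suc S) + 1) (m' ⊓ n') noCopy
  where
    noCopy : ¬ BlockCopy G (suc S) (m' ⊓ n') (2 * suc (suc S) + 1) (colouring₃ S)
    noCopy copy = colouring₃-noCorners S b₁<bₘ bₘ≤bₘ₊₁ bₘ₊₁<bₘ₊ₙ (<2[2+S]+1⇒≤last₂ bₘ₊ₙ<B)
                    (edge-colour refl toℕ-vₘ₊₁ (s≤s z≤n) adj₁)
                    (edge-colour toℕ-vₘ toℕ-vₘ₊₁ (n<1+n m') adj₃)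
                    (edge-colour toℕ-vₘ toℕ-vₘ₊ₙ (m<m+n m' (s≤s z≤n)) adj₂)
      where open Corners c split copy (m⊓n≤m m' n') (m⊓n≤n m' n')

corollary3 : (t : ℕ) → 2 ≤ t →
    ((m n : ℕ) (G : OrderedGraph (m + n)) (c : IntervalColoring G 2) →
      IChromatic G 2 → PartsSplitAt {m} {n} c → Stitched c →
      RamseyAtLeast t G (2 * t * (m ⊓ n ∸ 1) + 1))
    ×
    ((m n : ℕ) (G : OrderedGraph (m + n)) (c : IntervalColoring G 2) →
      IChromatic G 2 → PartsSplitAt {m} {n} c → Stitched c →
      AdjN G 0 (m + n ∸ 1) → AdjN G (m ∸ 1) m →
      RamseyAtLeast t G ((2 * t + 1) * (m ⊓ n ∸ 1) + 1))
    ×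
    ((m n : ℕ) (G : OrderedGraph (m + n)) (c : IntervalColoring G 2) →
      IChromatic G 2 → PartsSplitAt {m} {n} c →
      AdjN G 0 m → AdjN G (m ∸ 1) (m + n ∸ 1) → AdjN G (m ∸ 1) m →
      RamseyAtLeast t G ((2 * t + 1) * (m ⊓ n ∸ 1) + 1))
corollary3 zero ()
corollary3 (suc zero) (s≤s ())
corollary3 (suc (suc S)) _ =
  (λ m n G c _ → part₁ (suc S) m n G c) ,
  (λ m n G c _ → part₂ S m n G c) ,
  (λ m n G c _ → part₃ S m n G c)
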